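{- The quantifier-elimination rewrite relation $\to$ on formulas is locally confluent. That is, whenever $F_0\to F_1$ and $F_0\to F_2$, there is a formula $G$ with $F_1\to^* G$ and $F_2\to^* G$.
   Context: Terms and formulas are those of first-order logic extended by Hilbert's $\varepsilon$-binder. The syntax has: - individual variables; - formula variables; - function and predicate symbols; - connectives; - for an individual variable $x$ and a formula $F$: the term $\varepsilon x.\,F$ and the formulas $\exists x.\,F$ and $\forall x.\,F$, each binding $x$. Formulas are identified modulo renaming of bound variables. Substitution $F\{x\mapsto t\}$ is capture-avoiding. For $Q\in\{\exists,\forall\}$, write $\neg^{\forall}$ for $\neg$ and $\neg^{\exists}$ for the empty string. The relation $F\to G$ holds iff $G$ is obtained from $F$ by replacing one occurrence of a subformula $Qx.\,A$ by $A\{x\mapsto\varepsilon x.\,\neg^Q A\}$. The occurrence may lie anywhere in $F$, including inside $\varepsilon$-terms and under binders. $\to^*$ denotes the reflexive transitive closure of $\to$. -}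

module Defs where

-- First-order logic extended with Hilbert's ε-binder, in de Bruijn
-- representation, so that formulas are identified modulo renaming of
-- bound variables (α-equivalence is syntactic equality).
-- An individual variable is 'var i'; indices below the current binder
-- depth refer to bound variables, the others are free variables.

open import Data.Nat using (ℕ; zero; suc)
open import Relation.Binary.Construct.Closure.ReflexiveTransitive using (Star)

data BinOp : Set where
  and or imp iff : BinOp

data Quant : Set where
  ∃q ∀q : Quant

mutual
  data Term : Set where
    var : ℕ → Term
    fun : ℕ → Terms → Term
    eps : Formula → Term                 -- ε x. F   (body under one binder)

  data Terms : Set where
    []  : Terms
    _∷_ : Term → Terms → Terms

  data Formula : Set where
    fvar  : ℕ → Formula
    pred  : ℕ → Terms → Formula
    ⊤f ⊥f : Formula
    neg   : Formula → Formula
    bin   : BinOp → Formula → Formula → Formula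
    quant : Quant → Formula → Formula    -- Q x. F   (body under one binder)

mutual
  renT : (ℕ → ℕ) → Term → Term
  renT ρ (var i)   = var (ρ i)
  renT ρ (fun f ts) = fun f (renTs ρ ts)
  renT ρ (eps A)   = eps (renF (liftR ρ) A)

  renTs : (ℕ → ℕ) → Terms → Terms
  renTs ρ []       = []
  renTs ρ (t ∷ ts) = renT ρ t ∷ renTs ρ ts

  renF : (ℕ → ℕ) → Formula → Formula
  renF ρ (fvar X)      = fvar X
  renF ρ (pred p ts)   = pred p (renTs ρ ts)
  renF ρ ⊤f            = ⊤f
  renF ρ ⊥f            = ⊥f
  renF ρ (neg A)       = neg (renF ρ A)
  renF ρ (bin o A B)   = bin o (renF ρ A) (renF ρ B)
  renF ρ (quant Q A)   = quant Q (renF (liftR ρ) A)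

  liftR : (ℕ → ℕ) → ℕ → ℕ
  liftR ρ zero    = zero
  liftR ρ (suc i) = suc (ρ i)

exts : (ℕ → Term) → ℕ → Term
exts σ zero    = var zero
exts σ (suc i) = renT suc (σ i)

mutual
  subT : (ℕ → Term) → Term → Term
  subT σ (var i)    = σ i
  subT σ (fun f ts) = fun f (subTs σ ts)
  subT σ (eps A)    = eps (subF (exts σ) A)

  subTs : (ℕ → Term) → Terms → Terms
  subTs σ []       = []
  subTs σ (t ∷ ts) = subT σ t ∷ subTs σ ts

  subF : (ℕ → Term) → Formula → Formula
  subF σ (fvar X)    = fvar X
  subF σ (pred p ts) = pred p (subTs σ ts)
  subF σ ⊤f          = ⊤f
  subF σ ⊥f          = ⊥f
  subF σ (neg A)     = neg (subF σ A)
  subF σ (bin o A B) = bin o (subF σ A) (subF σ B)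
  subF σ (quant Q A) = quant Q (subF (exts σ) A)

sub0 : Term → ℕ → Term
sub0 t zero    = t
sub0 t (suc i) = var i

_[_] : Formula → Term → Formula
A [ t ] = subF (sub0 t) A

negQ : Quant → Formula → Formula
negQ ∃q A = A
negQ ∀q A = neg A

mutual
  data _⟶T_ : Term → Term → Set where
    funT : ∀ {f ts ts'} → ts ⟶Ts ts' → fun f ts ⟶T fun f ts'
    epsT : ∀ {A A'} → A ⟶ A' → eps A ⟶T eps A'

  data _⟶Ts_ : Terms → Terms → Set where
    hdTs : ∀ {t t' ts} → t ⟶T t' → (t ∷ ts) ⟶Ts (t' ∷ ts)
    tlTs : ∀ {t ts ts'} → ts ⟶Ts ts' → (t ∷ ts) ⟶Ts (t ∷ ts')

  data _⟶_ : Formula → Formula → Set where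
    elim  : ∀ Q A → quant Q A ⟶ (A [ eps (negQ Q A) ])
    predC : ∀ {p ts ts'} → ts ⟶Ts ts' → pred p ts ⟶ pred p ts'
    negC  : ∀ {A A'} → A ⟶ A' → neg A ⟶ neg A'
    binL  : ∀ {o A A' B} → A ⟶ A' → bin o A B ⟶ bin o A' B
    binR  : ∀ {o A B B'} → B ⟶ B' → bin o A B ⟶ bin o A B'
    quantC : ∀ {Q A A'} → A ⟶ A' → quant Q A ⟶ quant Q A'

_⟶*_ : Formula → Formula → Set
_⟶*_ = Star _⟶_

module Submission where

-- The only overlap that is not a disjoint or identical redex pair is
-- eliminating Q x. A while another step A ⟶ A' happens inside the body.
-- It closes as
--   A{x ↦ ε x. ¬^Q A} ⟶ A'{x ↦ ε x. ¬^Q A} ⟶* A'{x ↦ ε x. ¬^Q A'} ⟵ Q x. A',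
-- where the first step uses stability of ⟶ under substitution and the
-- second rewrites every copy of the substituted ε-term, i.e. parallel
-- substitution is monotone in the substituted terms.

open import Defs
open import Data.Product using (∃; _×_; _,_; map₂; swap)
open import Data.Nat using (zero; suc)
open import Function using (_∘_)
open import Relation.Binary.PropositionalEquality using (_≡_; refl; sym; trans; cong; cong₂; subst₂; module ≡-Reasoning)
open import Relation.Binary.Construct.Closure.ReflexiveTransitive using (Star; ε; _◅_; _◅◅_; gmap)
open import Relation.Binary.Rewriting using (WeaklyConfluent)

open ≡-Reasoning

liftR-∘ : ∀ {ρ₁ ρ₂ ρ} → (∀ i → ρ₁ (ρ₂ i) ≡ ρ i) → ∀ i → liftR ρ₁ (liftR ρ₂ i) ≡ liftR ρ i
liftR-∘ h zero    = refl
liftR-∘ h (suc i) = cong suc (h i)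

mutual
  renT-renT : ∀ {ρ₁ ρ₂ ρ} → (∀ i → ρ₁ (ρ₂ i) ≡ ρ i) → ∀ t → renT ρ₁ (renT ρ₂ t) ≡ renT ρ t
  renT-renT h (var i)    = cong var (h i)
  renT-renT h (fun f ts) = cong (fun f) (renTs-renTs h ts)
  renT-renT h (eps A)    = cong eps (renF-renF (liftR-∘ h) A)

  renTs-renTs : ∀ {ρ₁ ρ₂ ρ} → (∀ i → ρ₁ (ρ₂ i) ≡ ρ i) → ∀ ts → renTs ρ₁ (renTs ρ₂ ts) ≡ renTs ρ ts
  renTs-renTs h []       = refl
  renTs-renTs h (t ∷ ts) = cong₂ _∷_ (renT-renT h t) (renTs-renTs h ts)

  renF-renF : ∀ {ρ₁ ρ₂ ρ} → (∀ i → ρ₁ (ρ₂ i) ≡ ρ i) → ∀ A → renF ρ₁ (renF ρ₂ A) ≡ renF ρ A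
  renF-renF h (fvar X)    = refl
  renF-renF h (pred p ts) = cong (pred p) (renTs-renTs h ts)
  renF-renF h ⊤f          = refl
  renF-renF h ⊥f          = refl
  renF-renF h (neg A)     = cong neg (renF-renF h A)
  renF-renF h (bin o A B) = cong₂ (bin o) (renF-renF h A) (renF-renF h B)
  renF-renF h (quant Q A) = cong (quant Q) (renF-renF (liftR-∘ h) A)

exts-liftR : ∀ {σ ρ τ} → (∀ i → σ (ρ i) ≡ τ i) → ∀ i → exts σ (liftR ρ i) ≡ exts τ i
exts-liftR h zero    = refl
exts-liftR h (suc i) = cong (renT suc) (h i)

mutual
  subT-renT : ∀ {σ ρ τ} → (∀ i → σ (ρ i) ≡ τ i) → ∀ t → subT σ (renT ρ t) ≡ subT τ t
  subT-renT h (var i)    = h i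
  subT-renT h (fun f ts) = cong (fun f) (subTs-renTs h ts)
  subT-renT h (eps A)    = cong eps (subF-renF (exts-liftR h) A)

  subTs-renTs : ∀ {σ ρ τ} → (∀ i → σ (ρ i) ≡ τ i) → ∀ ts → subTs σ (renTs ρ ts) ≡ subTs τ ts
  subTs-renTs h []       = refl
  subTs-renTs h (t ∷ ts) = cong₂ _∷_ (subT-renT h t) (subTs-renTs h ts)

  subF-renF : ∀ {σ ρ τ} → (∀ i → σ (ρ i) ≡ τ i) → ∀ A → subF σ (renF ρ A) ≡ subF τ A
  subF-renF h (fvar X)    = refl
  subF-renF h (pred p ts) = cong (pred p) (subTs-renTs h ts)
  subF-renF h ⊤f          = refl
  subF-renF h ⊥f          = refl
  subF-renF h (neg A)     = cong neg (subF-renF h A)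
  subF-renF h (bin o A B) = cong₂ (bin o) (subF-renF h A) (subF-renF h B)
  subF-renF h (quant Q A) = cong (quant Q) (subF-renF (exts-liftR h) A)

liftR-exts : ∀ {ρ σ τ} → (∀ i → renT ρ (σ i) ≡ τ i) → ∀ i → renT (liftR ρ) (exts σ i) ≡ exts τ i
liftR-exts h zero = refl
liftR-exts {ρ} {σ} {τ} h (suc i) = begin
  renT (liftR ρ) (renT suc (σ i)) ≡⟨ renT-renT (λ _ → refl) (σ i) ⟩
  renT (suc ∘ ρ) (σ i)            ≡⟨ renT-renT (λ _ → refl) (σ i) ⟨
  renT suc (renT ρ (σ i))         ≡⟨ cong (renT suc) (h i) ⟩
  renT suc (τ i)                  ∎

mutual
  renT-subT : ∀ {ρ σ τ} → (∀ i → renT ρ (σ i) ≡ τ i) → ∀ t → renT ρ (subT σ t) ≡ subT τ t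
  renT-subT h (var i)    = h i
  renT-subT h (fun f ts) = cong (fun f) (renTs-subTs h ts)
  renT-subT h (eps A)    = cong eps (renF-subF (liftR-exts h) A)

  renTs-subTs : ∀ {ρ σ τ} → (∀ i → renT ρ (σ i) ≡ τ i) → ∀ ts → renTs ρ (subTs σ ts) ≡ subTs τ ts
  renTs-subTs h []       = refl
  renTs-subTs h (t ∷ ts) = cong₂ _∷_ (renT-subT h t) (renTs-subTs h ts)

  renF-subF : ∀ {ρ σ τ} → (∀ i → renT ρ (σ i) ≡ τ i) → ∀ A → renF ρ (subF σ A) ≡ subF τ A
  renF-subF h (fvar X)    = refl
  renF-subF h (pred p ts) = cong (pred p) (renTs-subTs h ts)
  renF-subF h ⊤f          = refl
  renF-subF h ⊥f          = refl
  renF-subF h (neg A)     = cong neg (renF-subF h A)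
  renF-subF h (bin o A B) = cong₂ (bin o) (renF-subF h A) (renF-subF h B)
  renF-subF h (quant Q A) = cong (quant Q) (renF-subF (liftR-exts h) A)

exts-exts : ∀ {σ τ υ} → (∀ i → subT σ (τ i) ≡ υ i) → ∀ i → subT (exts σ) (exts τ i) ≡ exts υ i
exts-exts h zero = refl
exts-exts {σ} {τ} {υ} h (suc i) = begin
  subT (exts σ) (renT suc (τ i)) ≡⟨ subT-renT (λ _ → refl) (τ i) ⟩
  subT (renT suc ∘ σ) (τ i)      ≡⟨ renT-subT (λ _ → refl) (τ i) ⟨
  renT suc (subT σ (τ i))        ≡⟨ cong (renT suc) (h i) ⟩
  renT suc (υ i)                 ∎

mutual
  subT-subT : ∀ {σ τ υ} → (∀ i → subT σ (τ i) ≡ υ i) → ∀ t → subT σ (subT τ t) ≡ subT υ t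
  subT-subT h (var i)    = h i
  subT-subT h (fun f ts) = cong (fun f) (subTs-subTs h ts)
  subT-subT h (eps A)    = cong eps (subF-subF (exts-exts h) A)

  subTs-subTs : ∀ {σ τ υ} → (∀ i → subT σ (τ i) ≡ υ i) → ∀ ts → subTs σ (subTs τ ts) ≡ subTs υ ts
  subTs-subTs h []       = refl
  subTs-subTs h (t ∷ ts) = cong₂ _∷_ (subT-subT h t) (subTs-subTs h ts)

  subF-subF : ∀ {σ τ υ} → (∀ i → subT σ (τ i) ≡ υ i) → ∀ A → subF σ (subF τ A) ≡ subF υ A
  subF-subF h (fvar X)    = refl
  subF-subF h (pred p ts) = cong (pred p) (subTs-subTs h ts)
  subF-subF h ⊤f          = refl
  subF-subF h ⊥f          = refl
  subF-subF h (neg A)     = cong neg (subF-subF h A)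
  subF-subF h (bin o A B) = cong₂ (bin o) (subF-subF h A) (subF-subF h B)
  subF-subF h (quant Q A) = cong (quant Q) (subF-subF (exts-exts h) A)

exts-var : ∀ {ρ σ} → (∀ i → var (ρ i) ≡ σ i) → ∀ i → var (liftR ρ i) ≡ exts σ i
exts-var h zero    = refl
exts-var h (suc i) = cong (renT suc) (h i)

mutual
  renT-as-subT : ∀ {ρ σ} → (∀ i → var (ρ i) ≡ σ i) → ∀ t → renT ρ t ≡ subT σ t
  renT-as-subT h (var i)    = h i
  renT-as-subT h (fun f ts) = cong (fun f) (renTs-as-subTs h ts)
  renT-as-subT h (eps A)    = cong eps (renF-as-subF (exts-var h) A)

  renTs-as-subTs : ∀ {ρ σ} → (∀ i → var (ρ i) ≡ σ i) → ∀ ts → renTs ρ ts ≡ subTs σ ts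
  renTs-as-subTs h []       = refl
  renTs-as-subTs h (t ∷ ts) = cong₂ _∷_ (renT-as-subT h t) (renTs-as-subTs h ts)

  renF-as-subF : ∀ {ρ σ} → (∀ i → var (ρ i) ≡ σ i) → ∀ A → renF ρ A ≡ subF σ A
  renF-as-subF h (fvar X)    = refl
  renF-as-subF h (pred p ts) = cong (pred p) (renTs-as-subTs h ts)
  renF-as-subF h ⊤f          = refl
  renF-as-subF h ⊥f          = refl
  renF-as-subF h (neg A)     = cong neg (renF-as-subF h A)
  renF-as-subF h (bin o A B) = cong₂ (bin o) (renF-as-subF h A) (renF-as-subF h B)
  renF-as-subF h (quant Q A) = cong (quant Q) (renF-as-subF (exts-var h) A)

exts-id : ∀ {σ} → (∀ i → σ i ≡ var i) → ∀ i → exts σ i ≡ var i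
exts-id h zero    = refl
exts-id h (suc i) = cong (renT suc) (h i)

mutual
  subT-id : ∀ {σ} → (∀ i → σ i ≡ var i) → ∀ t → subT σ t ≡ t
  subT-id h (var i)    = h i
  subT-id h (fun f ts) = cong (fun f) (subTs-id h ts)
  subT-id h (eps A)    = cong eps (subF-id (exts-id h) A)

  subTs-id : ∀ {σ} → (∀ i → σ i ≡ var i) → ∀ ts → subTs σ ts ≡ ts
  subTs-id h []       = refl
  subTs-id h (t ∷ ts) = cong₂ _∷_ (subT-id h t) (subTs-id h ts)

  subF-id : ∀ {σ} → (∀ i → σ i ≡ var i) → ∀ A → subF σ A ≡ A
  subF-id h (fvar X)    = refl
  subF-id h (pred p ts) = cong (pred p) (subTs-id h ts)
  subF-id h ⊤f          = refl
  subF-id h ⊥f          = refl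
  subF-id h (neg A)     = cong neg (subF-id h A)
  subF-id h (bin o A B) = cong₂ (bin o) (subF-id h A) (subF-id h B)
  subF-id h (quant Q A) = cong (quant Q) (subF-id (exts-id h) A)

subF-[] : ∀ σ A t → subF σ (A [ t ]) ≡ subF (exts σ) A [ subT σ t ]
subF-[] σ A t = trans (subF-subF (λ _ → refl) A) (sym (subF-subF sub0-exts A))
  where
  sub0-exts : ∀ i → subT (sub0 (subT σ t)) (exts σ i) ≡ subT σ (sub0 t i)
  sub0-exts zero    = refl
  sub0-exts (suc i) = trans (subT-renT (λ _ → refl) (σ i)) (subT-id (λ _ → refl) (σ i))

mutual
  subT-⟶T : ∀ σ {t t'} → t ⟶T t' → subT σ t ⟶T subT σ t'
  subT-⟶T σ (funT s) = funT (subTs-⟶Ts σ s)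
  subT-⟶T σ (epsT s) = epsT (subF-⟶ (exts σ) s)

  subTs-⟶Ts : ∀ σ {ts ts'} → ts ⟶Ts ts' → subTs σ ts ⟶Ts subTs σ ts'
  subTs-⟶Ts σ (hdTs s) = hdTs (subT-⟶T σ s)
  subTs-⟶Ts σ (tlTs s) = tlTs (subTs-⟶Ts σ s)

  subF-⟶ : ∀ σ {A A'} → A ⟶ A' → subF σ A ⟶ subF σ A'
  subF-⟶ σ (elim ∃q A) rewrite subF-[] σ A (eps A)       = elim ∃q _
  subF-⟶ σ (elim ∀q A) rewrite subF-[] σ A (eps (neg A)) = elim ∀q _
  subF-⟶ σ (predC s)  = predC (subTs-⟶Ts σ s)
  subF-⟶ σ (negC s)   = negC (subF-⟶ σ s)
  subF-⟶ σ (binL s)   = binL (subF-⟶ σ s)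
  subF-⟶ σ (binR s)   = binR (subF-⟶ σ s)
  subF-⟶ σ (quantC s) = quantC (subF-⟶ (exts σ) s)

renT-⟶T : ∀ ρ {t t'} → t ⟶T t' → renT ρ t ⟶T renT ρ t'
renT-⟶T ρ {t} {t'} s =
  subst₂ _⟶T_ (sym (renT-as-subT (λ _ → refl) t)) (sym (renT-as-subT (λ _ → refl) t')) (subT-⟶T (var ∘ ρ) s)

_⟶T*_ : Term → Term → Set
_⟶T*_ = Star _⟶T_

_⟶Ts*_ : Terms → Terms → Set
_⟶Ts*_ = Star _⟶Ts_

exts-⟶T* : ∀ {σ τ} → (∀ i → σ i ⟶T* τ i) → ∀ i → exts σ i ⟶T* exts τ i
exts-⟶T* h zero    = ε
exts-⟶T* h (suc i) = gmap (renT suc) (renT-⟶T suc) (h i)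

mutual
  subT-⟶T* : ∀ {σ τ} → (∀ i → σ i ⟶T* τ i) → ∀ t → subT σ t ⟶T* subT τ t
  subT-⟶T* h (var i)    = h i
  subT-⟶T* h (fun f ts) = gmap (fun f) funT (subTs-⟶Ts* h ts)
  subT-⟶T* h (eps A)    = gmap eps epsT (subF-⟶* (exts-⟶T* h) A)

  subTs-⟶Ts* : ∀ {σ τ} → (∀ i → σ i ⟶T* τ i) → ∀ ts → subTs σ ts ⟶Ts* subTs τ ts
  subTs-⟶Ts* h []             = ε
  subTs-⟶Ts* {σ} {τ} h (t ∷ ts) =
    gmap (_∷ subTs σ ts) hdTs (subT-⟶T* h t) ◅◅ gmap (subT τ t ∷_) tlTs (subTs-⟶Ts* h ts)

  subF-⟶* : ∀ {σ τ} → (∀ i → σ i ⟶T* τ i) → ∀ A → subF σ A ⟶* subF τ A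
  subF-⟶* h (fvar X)    = ε
  subF-⟶* h (pred p ts) = gmap (pred p) predC (subTs-⟶Ts* h ts)
  subF-⟶* h ⊤f          = ε
  subF-⟶* h ⊥f          = ε
  subF-⟶* h (neg A)     = gmap neg negC (subF-⟶* h A)
  subF-⟶* {σ} {τ} h (bin o A B) =
    gmap (λ X → bin o X (subF σ B)) binL (subF-⟶* h A) ◅◅ gmap (bin o (subF τ A)) binR (subF-⟶* h B)
  subF-⟶* h (quant Q A) = gmap (quant Q) quantC (subF-⟶* (exts-⟶T* h) A)

Joinable : {A : Set} → (A → A → Set) → A → A → Set
Joinable R b c = ∃ λ d → Star R b d × Star R c d

Joinable-map : ∀ {A B : Set} {R : A → A → Set} {S : B → B → Set} (f : A → B) →
  (∀ {x y} → R x y → S (f x) (f y)) → ∀ {b c} → Joinable R b c → Joinable S (f b) (f c)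
Joinable-map f f-step (d , b↠d , c↠d) = f d , gmap f f-step b↠d , gmap f f-step c↠d

negQ-⟶ : ∀ Q {A A'} → A ⟶ A' → negQ Q A ⟶ negQ Q A'
negQ-⟶ ∃q s = s
negQ-⟶ ∀q s = negC s

elim-quantC-joinable : ∀ Q {A A'} → A ⟶ A' → Joinable _⟶_ (A [ eps (negQ Q A) ]) (quant Q A')
elim-quantC-joinable Q {A} {A'} s =
  A' [ eps (negQ Q A') ] , subF-⟶ (sub0 (eps (negQ Q A))) s ◅ subF-⟶* ε-step A' , elim Q A' ◅ ε
  where
  ε-step : ∀ i → sub0 (eps (negQ Q A)) i ⟶T* sub0 (eps (negQ Q A')) i
  ε-step zero    = epsT (negQ-⟶ Q s) ◅ ε
  ε-step (suc i) = ε

mutual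
  ⟶T-weaklyConfluent : WeaklyConfluent _⟶T_
  ⟶T-weaklyConfluent (funT s) (funT s') = Joinable-map (fun _) funT (⟶Ts-weaklyConfluent s s')
  ⟶T-weaklyConfluent (epsT s) (epsT s') = Joinable-map eps epsT (⟶-weaklyConfluent s s')

  ⟶Ts-weaklyConfluent : WeaklyConfluent _⟶Ts_
  ⟶Ts-weaklyConfluent (hdTs s) (hdTs s') = Joinable-map (_∷ _) hdTs (⟶T-weaklyConfluent s s')
  ⟶Ts-weaklyConfluent (hdTs s) (tlTs s') = _ , tlTs s' ◅ ε , hdTs s ◅ ε
  ⟶Ts-weaklyConfluent (tlTs s) (hdTs s') = _ , hdTs s' ◅ ε , tlTs s ◅ ε
  ⟶Ts-weaklyConfluent (tlTs s) (tlTs s') = Joinable-map (_ ∷_) tlTs (⟶Ts-weaklyConfluent s s')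

  ⟶-weaklyConfluent : WeaklyConfluent _⟶_
  ⟶-weaklyConfluent (elim Q A) (elim .Q .A) = _ , ε , ε
  ⟶-weaklyConfluent (elim Q A) (quantC s)   = elim-quantC-joinable Q s
  ⟶-weaklyConfluent (quantC s) (elim Q A)   = map₂ swap (elim-quantC-joinable Q s)
  ⟶-weaklyConfluent (predC s)  (predC s')   = Joinable-map (pred _) predC (⟶Ts-weaklyConfluent s s')
  ⟶-weaklyConfluent (negC s)   (negC s')    = Joinable-map neg negC (⟶-weaklyConfluent s s')
  ⟶-weaklyConfluent (binL s)   (binL s')    = Joinable-map (λ X → bin _ X _) binL (⟶-weaklyConfluent s s')
  ⟶-weaklyConfluent (binL s)   (binR s')    = _ , binR s' ◅ ε , binL s ◅ ε
  ⟶-weaklyConfluent (binR s)   (binL s')    = _ , binL s' ◅ ε , binR s ◅ ε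
  ⟶-weaklyConfluent (binR s)   (binR s')    = Joinable-map (bin _ _) binR (⟶-weaklyConfluent s s')
  ⟶-weaklyConfluent (quantC s) (quantC s')  = Joinable-map (quant _) quantC (⟶-weaklyConfluent s s')

corollary3p4 : ∀ {F₀ F₁ F₂ : Formula} → F₀ ⟶ F₁ → F₀ ⟶ F₂ →
    ∃ λ (G : Formula) → (F₁ ⟶* G) × (F₂ ⟶* G)
corollary3p4 = ⟶-weaklyConfluent
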